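{- Let $G$ be a graph and $D\subseteq V(G)$. Then $D$ is a minimal dominating set of $G$ if and only if $D$ dominates $IR(G)$ and $Priv_{IR}(D,x)\neq\emptyset$ for every $x\in D$.
   Context: All graphs are finite, simple and undirected. $N[x]$ is the closed neighbourhood of $x$ and $N[X]=\bigcup_{x\in X}N[x]$; $D$ dominates $X$ if $X\subseteq N[D]$, and a minimal dominating set of $G$ is an inclusion-minimal set dominating $V(G)$. A vertex $x$ is irredundant if $N[x]$ is inclusion-minimal in $\{N[y]:y\in V(G)\}$, with the convention that among several vertices having the same inclusion-minimal closed neighbourhood exactly one (fixed) is declared irredundant; all other vertices are redundant; $IR(G)$ is the set of irredundant vertices. For $D\subseteq V(G)$ and $x\in D$, a private neighbour of $x$ w.r.t. $D$ is a vertex $u$ with $N[u]\cap D=\{x\}$ (possibly $u=x$), and $Priv_{IR}(D,x)$ is the set of such private neighbours lying in $IR(G)$. -}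

module Defs where

open import Data.Nat using (ℕ)
open import Data.Fin using (Fin)
open import Data.Fin.Subset using (Subset; _∈_; _⊆_; ⊤)
open import Data.Product using (Σ; ∃; _×_)
open import Data.Sum using (_⊎_)
open import Relation.Nullary using (¬_)
open import Relation.Binary using (Decidable)
open import Relation.Binary.PropositionalEquality using (_≡_)

record Graph (n : ℕ) : Set₁ where
  field
    Adj    : Fin n → Fin n → Set
    adj?   : Decidable Adj
    sym    : ∀ {x y} → Adj x y → Adj y x
    irrefl : ∀ {x} → ¬ Adj x x

module _ {n : ℕ} (G : Graph n) where
  open Graph G

  InN : Fin n → Fin n → Set
  InN x u = u ≡ x ⊎ Adj x u

  NSub : Fin n → Fin n → Set
  NSub x y = ∀ u → InN x u → InN y u

  SameN : Fin n → Fin n → Set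
  SameN x y = NSub x y × NSub y x

  NMinimal : Fin n → Set
  NMinimal x = ∀ y → NSub y x → NSub x y

  -- I is a valid set of irredundant vertices IR(G): exactly one
  -- (arbitrarily fixed) representative from each class of vertices
  -- sharing the same inclusion-minimal closed neighbourhood.
  IsIR : Subset n → Set
  IsIR I = (∀ x → x ∈ I → NMinimal x)
         × (∀ y → NMinimal y → ∃ λ x → x ∈ I × SameN x y)
         × (∀ x x' → x ∈ I → x' ∈ I → SameN x x' → x ≡ x')

  Dominates : Subset n → Subset n → Set
  Dominates D X = ∀ u → u ∈ X → ∃ λ d → d ∈ D × InN d u

  MinimalDominating : Subset n → Set
  MinimalDominating D =
    Dominates D ⊤ × (∀ D' → D' ⊆ D → Dominates D' ⊤ → D ⊆ D')

  PrivateNbr : Subset n → Fin n → Fin n → Set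
  PrivateNbr D x u = InN u x × (∀ d → d ∈ D → InN u d → d ≡ x)

  HasPrivIR : Subset n → Subset n → Fin n → Set
  HasPrivIR I D x = ∃ λ u → u ∈ I × PrivateNbr D x u

module Submission where

-- The key fact is that every vertex u lies above an irredundant vertex z,
-- i.e. N[z] ⊆ N[u]: among the finitely many closed neighbourhoods contained
-- in N[u] there is an inclusion-minimal one, found by well-founded descent
-- along strict inclusion of subsets (stated first for an arbitrary family of
-- subsets of a finite set), and IR contains a representative of its class.
-- Since N[z] ⊆ N[u], anything dominating z dominates u, and a vertex whose
-- closed neighbourhood meets D only in x passes this property down to z.
--
-- Hence (⇐) a set dominating IR dominates every vertex, and a private
-- neighbour of x forces x into every dominating subset of D; while (⇒) for
-- x in a minimal dominating set D the set D - x misses some vertex u, so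
-- N[u] ∩ D ⊆ {x}, and an irredundant vertex below u is a private neighbour
-- of x.

open import Defs
open import Data.Nat using (ℕ)
open import Data.Fin using (Fin; _≟_)
open import Data.Fin.Properties using (any?)
open import Data.Fin.Subset using (Subset; _∈_; _⊆_; _⊂_; ⊤; _-_; ⁅_⁆)
open import Data.Fin.Subset.Properties
  using (_∈?_; _⊂?_; ⊆-trans; ∈⊤; p─q⊆p; x∈p∧x≢y⇒x∈p-y; x∈p⇒p-x⊂p)
open import Data.Fin.Subset.Induction using (⊂-wellFounded)
open import Data.Vec using (tabulate)
open import Data.Vec.Properties using (lookup∘tabulate; lookup⇒[]=; []=⇒lookup)
open import Data.Product using (_×_; _,_; proj₁; proj₂; ∃)
open import Data.Sum using (inj₁; inj₂)
open import Function using (id)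
open import Function.Bundles using (_⇔_; mk⇔)
open import Induction.WellFounded using (Acc; acc)
open import Relation.Nullary using (Dec; yes; no; does; contradiction)
open import Relation.Nullary.Decidable using (_⊎-dec_; _×-dec_; ¬?; dec-true; decidable-stable)
import Relation.Unary as U
open import Relation.Binary.PropositionalEquality using (_≡_; refl; sym; trans)

subsetOf : ∀ {n p} {P : U.Pred (Fin n) p} → U.Decidable P → Subset n
subsetOf P? = tabulate (λ u → does (P? u))

module _ {n p} {P : U.Pred (Fin n) p} (P? : U.Decidable P) where

  ∈-subsetOf : ∀ {u} → P u → u ∈ subsetOf P?
  ∈-subsetOf {u} pu = lookup⇒[]= u _ (trans (lookup∘tabulate _ u) (dec-true (P? u) pu))

  subsetOf-∈ : ∀ {u} → u ∈ subsetOf P? → P u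
  subsetOf-∈ {u} u∈ with P? u | trans (sym (lookup∘tabulate (λ v → does (P? v)) u)) ([]=⇒lookup u∈)
  ... | yes pu | _  = pu
  ... | no _   | ()

-- Proof: well-founded
-- recursion on strict inclusion; if no member lies strictly below N x, then
-- N x itself is minimal, because failure of N x ⊆ N z would exhibit N z ⊂ N x.
minimal-below : ∀ {k m} (N : Fin k → Subset m) (x : Fin k) →
  ∃ λ y → N y ⊆ N x × (∀ z → N z ⊆ N y → N y ⊆ N z)
minimal-below N x = descend x (⊂-wellFounded (N x))
  where
  descend : ∀ x → Acc _⊂_ (N x) → ∃ λ y → N y ⊆ N x × (∀ z → N z ⊆ N y → N y ⊆ N z)
  descend x (acc below) with any? (λ z → N z ⊂? N x)
  ... | yes (z , z⊂x) with descend z (below z⊂x)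
  ...   | y , y⊆z , y-min = y , ⊆-trans y⊆z (proj₁ z⊂x) , y-min
  descend x (acc below) | no nothing-below = x , id , x-min
    where
    x-min : ∀ z → N z ⊆ N x → N x ⊆ N z
    x-min z z⊆x {v} v∈x = decidable-stable (v ∈? N z)
      (λ v∉z → nothing-below (z , z⊆x , v , v∈x , v∉z))

module _ {n : ℕ} (G : Graph n) where
  open Graph G renaming (sym to adj-sym)

  InN? : ∀ x u → Dec (InN G x u)
  InN? x u = (u ≟ x) ⊎-dec adj? x u

  dominated? : ∀ D u → Dec (∃ λ d → d ∈ D × InN G d u)
  dominated? D u = any? (λ d → (d ∈? D) ×-dec InN? d u)

  InN-sym : ∀ {x u} → InN G x u → InN G u x
  InN-sym (inj₁ refl) = inj₁ refl
  InN-sym (inj₂ xu)   = inj₂ (adj-sym xu)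

  closedNbhd : Fin n → Subset n
  closedNbhd x = subsetOf (InN? x)

  NSub⇒⊆ : ∀ {x y} → NSub G x y → closedNbhd x ⊆ closedNbhd y
  NSub⇒⊆ x⊆y u∈ = ∈-subsetOf (InN? _) (x⊆y _ (subsetOf-∈ (InN? _) u∈))

  ⊆⇒NSub : ∀ {x y} → closedNbhd x ⊆ closedNbhd y → NSub G x y
  ⊆⇒NSub x⊆y u u∈ = subsetOf-∈ (InN? _) (x⊆y (∈-subsetOf (InN? _) u∈))

  irredundant-below : ∀ {IR} → IsIR G IR → ∀ u → ∃ λ z → z ∈ IR × NSub G z u
  irredundant-below (_ , represented , _) u
    with minimal-below closedNbhd u
  ... | y , y⊆u , y-min with represented y (λ z z⊆y → ⊆⇒NSub (y-min z (NSub⇒⊆ z⊆y)))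
  ...   | z , z∈IR , (z⊆y , _) = z , z∈IR , λ v v∈ → ⊆⇒NSub y⊆u v (z⊆y v v∈)

  dominator-lifts : ∀ {z u d} → NSub G z u → InN G d z → InN G d u
  dominator-lifts z⊆u dz = InN-sym (z⊆u _ (InN-sym dz))

  dominates-IR⇒dominates : ∀ {IR D} → IsIR G IR → Dominates G D IR → Dominates G D ⊤
  dominates-IR⇒dominates isIR domIR u _ with irredundant-below isIR u
  ... | z , z∈IR , z⊆u with domIR z z∈IR
  ...   | d , d∈D , dz = d , d∈D , dominator-lifts z⊆u dz

  -- A vertex with a private neighbour w.r.t. D belongs to every dominating
  -- subset of D, since that subset must dominate the private neighbour.
  private-forces-membership : ∀ {D D' x w} → PrivateNbr G D x w →
    D' ⊆ D → Dominates G D' ⊤ → x ∈ D'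
  private-forces-membership {w = w} (_ , only-x) D'⊆D domD' with domD' w ∈⊤
  ... | d , d∈D' , dw with only-x d (D'⊆D d∈D') (InN-sym dw)
  ...   | refl = d∈D'

  private-below : ∀ {D x u z} → Dominates G D ⊤ →
    (∀ d → d ∈ D → InN G u d → d ≡ x) → NSub G z u → PrivateNbr G D x z
  private-below {z = z} domD only-x z⊆u with domD z ∈⊤
  ... | d , d∈D , dz with only-x d d∈D (z⊆u d (InN-sym dz))
  ...   | refl = InN-sym dz , λ d' d'∈D zd' → only-x d' d'∈D (z⊆u d' zd')

  -- In a minimal dominating set D, each x ∈ D is the only vertex of D
  -- dominating some vertex u: otherwise D - x would still dominate.
  minimal⇒sole-dominator : ∀ {D x} → MinimalDominating G D → x ∈ D →
    ∃ λ u → ∀ d → d ∈ D → InN G u d → d ≡ x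
  minimal⇒sole-dominator {D} {x} (_ , minimal) x∈D
    with any? (λ u → ¬? (dominated? (D - x) u))
  ... | yes (u , undominated) = u , only-x
    where
    only-x : ∀ d → d ∈ D → InN G u d → d ≡ x
    only-x d d∈D ud with d ≟ x
    ... | yes d≡x = d≡x
    ... | no  d≢x = contradiction (d , x∈p∧x≢y⇒x∈p-y d∈D d≢x , InN-sym ud) undominated
  ... | no all-dominated with x∈p⇒p-x⊂p x∈D
  ...   | _ , v , v∈D , v∉D-x = contradiction (D⊆D-x v∈D) v∉D-x
    where
    D⊆D-x : D ⊆ D - x
    D⊆D-x = minimal (D - x) (p─q⊆p D ⁅ x ⁆)
      (λ u _ → decidable-stable (dominated? (D - x) u) (λ ¬dom → all-dominated (u , ¬dom)))

proposition2 : ∀ {n : ℕ} (G : Graph n) (IR : Subset n) → IsIR G IR → (D : Subset n) →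
    MinimalDominating G D ⇔ (Dominates G D IR × (∀ x → x ∈ D → HasPrivIR G IR D x))
proposition2 G IR isIR D = mk⇔ minimal⇒private minimal⇐private
  where
  minimal⇒private : MinimalDominating G D →
    Dominates G D IR × (∀ x → x ∈ D → HasPrivIR G IR D x)
  minimal⇒private isMin@(domD , _) = (λ u _ → domD u ∈⊤) , has-private
    where
    has-private : ∀ x → x ∈ D → HasPrivIR G IR D x
    has-private x x∈D with minimal⇒sole-dominator G isMin x∈D
    ... | u , only-x with irredundant-below G isIR u
    ...   | z , z∈IR , z⊆u = z , z∈IR , private-below G domD only-x z⊆u

  minimal⇐private : Dominates G D IR × (∀ x → x ∈ D → HasPrivIR G IR D x) →
    MinimalDominating G D
  minimal⇐private (domIR , has-private) =
    dominates-IR⇒dominates G isIR domIR ,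
    λ D' D'⊆D domD' {x} x∈D → private-forces-membership G
      (proj₂ (proj₂ (has-private x x∈D))) D'⊆D domD'
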